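{- Let $a,b>0$ be integers with $a\mid b$, and let $b=\prod_i p_i^{b_i}$ be the prime factorization of $b$. Then $\mathrm{alcm}_a b=\gcd\big((b/a)^k,\,b\big)$ for every integer $k$ with $k\ge b_i$ for all $i$.
   Context: For integers $a,b>0$ with $a\mid b$, the anti-lcm $\mathrm{alcm}_a b$ of $b$ with respect to $a$ is the smallest positive integer $c$ such that $\lcm(a,c)=b$. -}

module Defs where

open import Data.Nat using (ℕ; _<_; _≤_)
open import Data.Nat.LCM using (lcm)
open import Data.Product using (_×_)
open import Relation.Binary.PropositionalEquality using (_≡_)

IsAlcm : ℕ → ℕ → ℕ → Set
IsAlcm a b c = (0 < c) × (lcm a c ≡ b) × (∀ d → 0 < d → lcm a d ≡ b → c ≤ d)

{-# OPTIONS --safe #-}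
-- With m = b / a, c = gcd (mᵏ, b) and b = e · c: a prime p dividing e and m
-- would divide c to every power i ≤ k (as pⁱ ∣ mᵏ and pⁱ ∣ p · c ∣ b), so
-- p ^ (k + 1) ∣ p · c ∣ b. Hence e is coprime to m, thus to c, and divides a,
-- so e · c = b divides lcm (a, c). Conversely, lcm (a, d) = b forces
-- d = gcd (a, d) · m and b = (a / gcd (a, d)) · d, where a / gcd (a, d) is
-- coprime to m and hence to c; so c ∣ d.
module Submission where

open import Defs
open import Data.Nat using (ℕ; _<_; _^_; _/_; suc; NonZero)
open import Data.Nat.Divisibility using (_∣_)
open import Data.Nat.GCD using (gcd)
open import Data.Nat.Primality using (Prime)
open import Relation.Nullary using (¬_)

open import Data.Nat.Base
  using (zero; _*_; _≤_; s≤s; NonTrivial; nonTrivial⇒≢1; ≢-nonZero; ≢-nonZero⁻¹; >-nonZero)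
open import Data.Nat.Properties
  using (*-comm; *-assoc; *-cancelˡ-≡; ≤-refl; <⇒≤; n≢0⇒n>0; *-commutativeSemigroup)
open import Data.Nat.Divisibility
  using (divides; _∣0; 1∣_; ∣-refl; ∣-trans; ∣-antisym; ∣1⇒≡1; ∣⇒≤
        ; *-pres-∣; *-monoʳ-∣; *-monoˡ-∣; m∣m*n; quotient; quotient-∣; m∣n⇒n≡quotient*m)
open import Data.Nat.DivMod using (m/n*n≡m; m*[n/m]≡n; m*n/n≡m)
open import Data.Nat.GCD using (gcd[m,n]∣m; gcd[m,n]∣n; gcd-greatest; gcd[m,n]≢0)
open import Data.Nat.LCM using (lcm; lcm-least; m∣lcm[m,n]; n∣lcm[m,n]; gcd*lcm)
open import Data.Nat.Coprimality as Coprimality using (Coprime; coprime-divisor; coprime-/gcd)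
open import Data.Nat.Primality using (prime[2]; euclidsLemma; ¬prime[1])
open import Data.Nat.Primality.Factorisation using (factorise)
open import Data.Nat.ListAction using (product)
open import Data.List.Base using ([]; _∷_)
open import Data.List.Relation.Unary.All using (_∷_)
open import Data.Product using (∃-syntax; _×_; _,_)
open import Data.Sum using (inj₁; inj₂)
open import Data.Empty using (⊥; ⊥-elim)
open import Relation.Nullary using (contradiction)
open import Relation.Binary.PropositionalEquality
  using (_≡_; refl; sym; trans; cong; subst; module ≡-Reasoning)
open import Algebra.Properties.CommutativeSemigroup *-commutativeSemigroup using (x∙yz≈y∙xz)

^-monoˡ-∣ : ∀ {m n} k → m ∣ n → m ^ k ∣ n ^ k
^-monoˡ-∣ zero    _   = ∣-refl
^-monoˡ-∣ (suc k) m∣n = *-pres-∣ m∣n (^-monoˡ-∣ k m∣n)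

^-monoʳ-∣ : ∀ m {i j} → i ≤ j → m ^ i ∣ m ^ j
^-monoʳ-∣ m {zero}  _         = 1∣ _
^-monoʳ-∣ m {suc i} (s≤s i≤j) = *-monoʳ-∣ m (^-monoʳ-∣ m i≤j)

prime∣^⇒prime∣ : ∀ {p m} k → Prime p → p ∣ m ^ k → p ∣ m
prime∣^⇒prime∣ zero p-prime p∣1 = contradiction (subst Prime (∣1⇒≡1 p∣1) p-prime) ¬prime[1]
prime∣^⇒prime∣ {m = m} (suc k) p-prime p∣m^[1+k]
  with euclidsLemma m (m ^ k) p-prime p∣m^[1+k]
... | inj₁ p∣m   = p∣m
... | inj₂ p∣m^k = prime∣^⇒prime∣ k p-prime p∣m^k

nonTrivial⇒∃prime∣ : ∀ n → .{{NonTrivial n}} → ∃[ p ] Prime p × p ∣ n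
nonTrivial⇒∃prime∣ n@(suc _) with factorise n
... | record { factors = [] ; isFactorisation = n≡1 } = contradiction n≡1 nonTrivial⇒≢1
... | record { factors = p ∷ ps ; isFactorisation = n≡p*ps ; factorsPrime = p-prime ∷ _ } =
  p , p-prime , subst (p ∣_) (sym n≡p*ps) (m∣m*n (product ps))

-- No positivity hypothesis is needed: if m = n = 0 then 2 is a common prime.
¬common-prime⇒coprime : ∀ {m n} → (∀ {p} → Prime p → p ∣ m → p ∣ n → ⊥) → Coprime m n
¬common-prime⇒coprime noCommon {zero} (0∣m , 0∣n) =
  ⊥-elim (noCommon prime[2] (∣-trans (2 ∣0) 0∣m) (∣-trans (2 ∣0) 0∣n))
¬common-prime⇒coprime noCommon {suc zero} _ = refl
¬common-prime⇒coprime noCommon {i@(suc (suc _))} (i∣m , i∣n)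
  with nonTrivial⇒∃prime∣ i
... | p , p-prime , p∣i = ⊥-elim (noCommon p-prime (∣-trans p∣i i∣m) (∣-trans p∣i i∣n))

coprime∧∣^⇒coprime : ∀ {m n o} k → Coprime m n → o ∣ n ^ k → Coprime m o
coprime∧∣^⇒coprime k m⊥n o∣n^k = ¬common-prime⇒coprime λ p-prime p∣m p∣o →
  ¬prime[1] (subst Prime (m⊥n (p∣m , prime∣^⇒prime∣ k p-prime (∣-trans p∣o o∣n^k))) p-prime)

coprime∧∣∧∣⇒*∣ : ∀ {m n o} → Coprime m n → m ∣ o → n ∣ o → m * n ∣ o
coprime∧∣∧∣⇒*∣ {m} {n} m⊥n m∣o (divides q o≡q*n) =
  subst (m * n ∣_) (sym o≡q*n) (*-monoˡ-∣ n (coprime-divisor m⊥n m∣n*q))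
  where
  m∣n*q : m ∣ n * q
  m∣n*q = subst (m ∣_) (trans o≡q*n (*-comm q n)) m∣o

*gcd[^,n]∣n⇒^suc∣n : ∀ {p m n} k → p ∣ m → p * gcd (m ^ k) n ∣ n → p ^ suc k ∣ n
*gcd[^,n]∣n⇒^suc∣n {p} {m} {n} k p∣m p*c∣n =
  ∣-trans (*-monoʳ-∣ p (p^i∣c ≤-refl)) p*c∣n
  where
  p^i∣c : ∀ {i} → i ≤ k → p ^ i ∣ gcd (m ^ k) n
  p^i∣c {zero}  _     = 1∣ _
  p^i∣c {suc i} 1+i≤k = gcd-greatest
    (∣-trans (^-monoʳ-∣ p 1+i≤k) (^-monoˡ-∣ k p∣m))
    (∣-trans (*-monoʳ-∣ p (p^i∣c (<⇒≤ 1+i≤k))) p*c∣n)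

lcm≡*⇒≡gcd* : ∀ a {d m} → .{{NonZero a}} → lcm a d ≡ a * m → d ≡ gcd a d * m
lcm≡*⇒≡gcd* a {d} {m} lcm≡a*m = *-cancelˡ-≡ d (gcd a d * m) a (begin
  a * d             ≡⟨ gcd*lcm a d ⟨
  gcd a d * lcm a d ≡⟨ cong (gcd a d *_) lcm≡a*m ⟩
  gcd a d * (a * m) ≡⟨ x∙yz≈y∙xz (gcd a d) a m ⟩
  a * (gcd a d * m) ∎)
  where open ≡-Reasoning

lcm≡*∧∣∧∣^⇒∣ : ∀ a {d m o} k → .{{NonZero a}} →
  lcm a d ≡ a * m → o ∣ a * m → o ∣ m ^ k → o ∣ d
lcm≡*∧∣∧∣^⇒∣ a {d} {m} {o} k lcm≡a*m o∣a*m o∣m^k =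
  coprime-divisor (Coprimality.sym (coprime∧∣^⇒coprime k a′⊥m o∣m^k))
                  (subst (o ∣_) a*m≡a′*d o∣a*m)
  where
  g a′ : ℕ
  g = gcd a d
  instance
    g≢0 : NonZero g
    g≢0 = ≢-nonZero (gcd[m,n]≢0 a d (inj₁ (≢-nonZero⁻¹ a)))
  a′ = a / g
  d≡g*m : d ≡ g * m
  d≡g*m = lcm≡*⇒≡gcd* a lcm≡a*m
  a′⊥m : Coprime a′ m
  a′⊥m = subst (Coprime a′) d/g≡m (coprime-/gcd a d)
    where
    d/g≡m : d / g ≡ m
    d/g≡m = trans (cong (_/ g) (trans d≡g*m (*-comm g m))) (m*n/n≡m m g)
  a*m≡a′*d : a * m ≡ a′ * d
  a*m≡a′*d = begin
    a * m        ≡⟨ cong (_* m) (m/n*n≡m (gcd[m,n]∣m a d)) ⟨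
    a′ * g * m   ≡⟨ *-assoc a′ g m ⟩
    a′ * (g * m) ≡⟨ cong (a′ *_) d≡g*m ⟨
    a′ * d       ∎
    where open ≡-Reasoning

theorem17 : (a b : ℕ) → .{{_ : NonZero a}} → 0 < a → 0 < b → a ∣ b →
    (k : ℕ) → (∀ p → Prime p → ¬ (p ^ suc k ∣ b)) →
    IsAlcm a b (gcd ((b / a) ^ k) b)
theorem17 a b _ b>0 a∣b k hyp = c>0 , lcm[a,c]≡b , c-minimal
  where
  m c e : ℕ
  m = b / a
  c = gcd (m ^ k) b
  c∣b : c ∣ b
  c∣b = gcd[m,n]∣n (m ^ k) b
  e = quotient c∣b

  c∣m^k : c ∣ m ^ k
  c∣m^k = gcd[m,n]∣m (m ^ k) b
  a*m≡b : a * m ≡ b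
  a*m≡b = m*[n/m]≡n a∣b
  b≡e*c : b ≡ e * c
  b≡e*c = m∣n⇒n≡quotient*m c∣b

  c>0 : 0 < c
  c>0 = n≢0⇒n>0 (gcd[m,n]≢0 (m ^ k) b (inj₂ (≢-nonZero⁻¹ b {{>-nonZero b>0}})))

  e⊥m : Coprime e m
  e⊥m = ¬common-prime⇒coprime λ {p} p-prime p∣e p∣m → hyp p p-prime
    (*gcd[^,n]∣n⇒^suc∣n k p∣m (subst (p * c ∣_) (sym b≡e*c) (*-monoˡ-∣ c p∣e)))

  e∣a : e ∣ a
  e∣a = coprime-divisor e⊥m (subst (e ∣_) (trans (sym a*m≡b) (*-comm a m)) (quotient-∣ c∣b))

  lcm[a,c]≡b : lcm a c ≡ b
  lcm[a,c]≡b = ∣-antisym (lcm-least a∣b c∣b) (subst (_∣ lcm a c) (sym b≡e*c)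
    (coprime∧∣∧∣⇒*∣ (coprime∧∣^⇒coprime k e⊥m c∣m^k)
                    (∣-trans e∣a (m∣lcm[m,n] a c)) (n∣lcm[m,n] a c)))

  c-minimal : ∀ d → 0 < d → lcm a d ≡ b → c ≤ d
  c-minimal d d>0 lcm[a,d]≡b = ∣⇒≤ {{>-nonZero d>0}}
    (lcm≡*∧∣∧∣^⇒∣ a k (trans lcm[a,d]≡b (sym a*m≡b)) (subst (c ∣_) (sym a*m≡b) c∣b) c∣m^k)
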